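{- Let $G_5$ be the transitive permutation group of degree $14$ numbered $30$ in the GAP library of transitive groups (a group of order $1092=2^2\cdot 3\cdot 7\cdot 13$). Every non-trivial $G_5$-invariant monotone boolean function $f(x_1,\dots,x_{14})$ is elusive.
   Context: Boolean functions of $x_1,\dots,x_n$ are viewed as functions on subsets $\boldsymbol{x}\subseteq\{x_1,\dots,x_n\}$. $f$ is elusive if its deterministic decision tree complexity $D(f)$ (minimum depth of a decision tree querying variables) equals $n$. $f$ is monotone if it is monotone non-increasing ($f(\boldsymbol{x})=1$ implies $f(\boldsymbol{x}')=1$ for all $\boldsymbol{x}'\subseteq\boldsymbol{x}$) or monotone non-decreasing ($f(\boldsymbol{x})=0$ implies $f(\boldsymbol{x}')=0$ for all $\boldsymbol{x}'\subseteq\boldsymbol{x}$). A permutation $\sigma$ acts on inputs by $\sigma(\{x_{a_1},\dots,x_{a_m}\})=\{x_{\sigma(a_1)},\dots,x_{\sigma(a_m)}\}$; $f$ is $G$-invariant if $f(\sigma(\boldsymbol{x}))=f(\boldsymbol{x})$ for all $\sigma\in G$ and all $\boldsymbol{x}$. Non-trivial means non-constant. -}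

module Defs where

open import Data.Bool using (Bool; true; false; if_then_else_)
open import Data.Nat using (ℕ; suc; _⊔_; _≤_)
open import Data.Fin using (Fin; #_)
open import Data.Fin.Properties using (all?; _≟_)
open import Data.Fin.Permutation using (Permutation′; permutation; _⟨$⟩ˡ_; _∘ₚ_; id)
open import Data.Vec using (Vec; []; _∷_; lookup)
open import Data.Product using (Σ; ∃; _×_; _,_)
open import Relation.Binary.PropositionalEquality using (_≡_; _≢_)
open import Relation.Nullary.Decidable using (toWitness; True)

Input : ℕ → Set
Input n = Fin n → Bool

BoolFun : ℕ → Set
BoolFun n = Input n → Bool

_⊆_ : ∀ {n} → Input n → Input n → Set
x' ⊆ x = ∀ i → x' i ≡ true → x i ≡ true

data DTree (n : ℕ) : Set where
  leaf  : Bool → DTree n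
  query : Fin n → DTree n → DTree n → DTree n

eval : ∀ {n} → DTree n → Input n → Bool
eval (leaf b)      x = b
eval (query i l r) x = if x i then eval r x else eval l x

depth : ∀ {n} → DTree n → ℕ
depth (leaf _)      = 0
depth (query _ l r) = suc (depth l ⊔ depth r)

Computes : ∀ {n} → DTree n → BoolFun n → Set
Computes t f = ∀ x → eval t x ≡ f x

Elusive : ∀ {n} → BoolFun n → Set
Elusive {n} f =
  (Σ (DTree n) λ t → Computes t f × depth t ≡ n) ×
  (∀ (t : DTree n) → Computes t f → n ≤ depth t)

MonotoneNonIncreasing : ∀ {n} → BoolFun n → Set
MonotoneNonIncreasing f = ∀ x x' → x' ⊆ x → f x ≡ true → f x' ≡ true

MonotoneNonDecreasing : ∀ {n} → BoolFun n → Set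
MonotoneNonDecreasing f = ∀ x x' → x' ⊆ x → f x ≡ false → f x' ≡ false

data Monotone {n} (f : BoolFun n) : Set where
  nonIncreasing : MonotoneNonIncreasing f → Monotone f
  nonDecreasing : MonotoneNonDecreasing f → Monotone f

NonTrivial : ∀ {n} → BoolFun n → Set
NonTrivial f = ∃ λ x → ∃ λ y → f x ≢ f y

-- σ({x_a : a ∈ x}) = {x_σ(a) : a ∈ x}; as a characteristic function:
-- j ∈ σ(x) iff σ⁻¹(j) ∈ x.
act : ∀ {n} → Permutation′ n → Input n → Input n
act σ x j = x (σ ⟨$⟩ˡ j)

Invariant : ∀ {n} → (Permutation′ n → Set) → BoolFun n → Set
Invariant G f = ∀ σ → G σ → ∀ x → f (act σ x) ≡ f x

-- G₅ = TransitiveGroup(14,30) ≅ PSL(2,13) acting on the projective line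
-- P¹(F₁₃) = {0,…,12,∞}; point k < 13 is the residue k, point 13 is ∞.
-- Generated by  t : z ↦ z + 1  and  s : z ↦ -1/z .

tTab : Vec (Fin 14) 14
tTab = # 1 ∷ # 2 ∷ # 3 ∷ # 4 ∷ # 5 ∷ # 6 ∷ # 7 ∷ # 8 ∷ # 9 ∷ # 10 ∷ # 11 ∷ # 12 ∷ # 0 ∷ # 13 ∷ []

tInvTab : Vec (Fin 14) 14
tInvTab = # 12 ∷ # 0 ∷ # 1 ∷ # 2 ∷ # 3 ∷ # 4 ∷ # 5 ∷ # 6 ∷ # 7 ∷ # 8 ∷ # 9 ∷ # 10 ∷ # 11 ∷ # 13 ∷ []

-- s(0)=∞, s(∞)=0, s(k) = -k⁻¹ mod 13
sTab : Vec (Fin 14) 14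
sTab = # 13 ∷ # 12 ∷ # 6 ∷ # 4 ∷ # 3 ∷ # 5 ∷ # 2 ∷ # 11 ∷ # 8 ∷ # 10 ∷ # 9 ∷ # 7 ∷ # 1 ∷ # 0 ∷ []

tabPerm : (f g : Vec (Fin 14) 14) →
          True (all? (λ i → lookup f (lookup g i) ≟ i)) →
          True (all? (λ i → lookup g (lookup f i) ≟ i)) →
          Permutation′ 14
tabPerm f g p q = permutation (lookup f) (lookup g) (toWitness p) (toWitness q)

genT : Permutation′ 14
genT = tabPerm tTab tInvTab _ _

genS : Permutation′ 14
genS = tabPerm sTab sTab _ _

-- G₅ as the subgroup of Sym(14) generated by t and s (closure under
-- composition; identity included; inverses are powers since G₅ is finite).
data G₅ : Permutation′ 14 → Set where
  g-id  : G₅ id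
  g-t   : G₅ genT
  g-s   : G₅ genS
  g-∘   : ∀ {σ τ} → G₅ σ → G₅ τ → G₅ (σ ∘ₚ τ)

module Submission where

-- The upper bound D(f) ≤ 14 is the complete decision tree.  The lower bound is the
-- Rivest–Vuillemin counting argument.  Since G₅ is transitive we may assume the root
-- queries x_∞.  If both subtrees had depth < 13, then on each hyperplane x_∞ = b the
-- signed sum Σ (-1)^|x| f(x) would vanish, because a decision tree shallower than the
-- dimension of a cube splits it into subcubes of positive dimension.  The translation
-- z ↦ z+1 fixes ∞ and rotates the 13 residues, so modulo 13 that sum only sees the
-- two points with constant residue coordinates: f agrees at the bottom and the top of
-- both hyperplanes.  Monotonicity and the involution z ↦ −1/z then give f(∅) = f(all).

open import Data.Bool as Bool using (Bool; true; false; if_then_else_)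
open import Data.Nat as ℕ using (ℕ; zero; suc; s≤s; _≤_; _<_; _⊔_; _≡ᵇ_)
import Data.Nat.Properties as ℕ
open import Data.Integer as ℤ using (ℤ; +_; -[1+_]; -_; _+_; _-_; _*_; _^_)
import Data.Integer.Properties as ℤ
open import Data.Integer.Divisibility.Signed using (_∣_; divides; _∣?_; ∣m∣n⇒∣m+n; ∣m∣n⇒∣m-n; ∣n⇒∣m*n)
open import Data.Integer.Tactic.RingSolver using (solve-∀)
open import Data.Fin using (Fin; toℕ; fromℕ<; inject₁; #_) renaming (zero to fz; suc to fs)
open import Data.Fin.Properties using (all?; toℕ-fromℕ<) renaming (_≟_ to _≟ᶠ_)
open import Data.Fin.Induction using (<-weakInduction)
open import Data.Fin.Permutation using (Permutation′; _⟨$⟩ˡ_; _∘ₚ_; id)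
open import Data.Vec using (Vec; []; _∷_; _∷ʳ_; lookup; replicate; map; allFin; tabulate; _[_]≔_)
import Data.Vec.Properties as Vecₚ
open import Data.Maybe using (Maybe; just; nothing)
open import Data.Product using (Σ; ∃; _×_; _,_)
open import Data.Unit using (⊤; tt)
open import Data.Empty using (⊥-elim)
open import Relation.Nullary using (¬_; yes; no)
open import Relation.Nullary.Decidable using (Dec; False; toWitness; toWitnessFalse; _→-dec_)
open import Relation.Binary.PropositionalEquality
open import Algebra.Properties.Semiring.Sum ℤ.+-*-semiring using (sum; *-distribʳ-sum; sum-cong-≗)
open import Algebra.Properties.CommutativeSemigroup ℕ.+-commutativeSemigroup using () renaming (x∙yz≈y∙xz to ℕ-+-left-comm)
open import Algebra.Properties.CommutativeSemigroup ℤ.+-commutativeSemigroup using () renaming (interchange to +-interchange)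
open import Algebra.Properties.CommutativeSemigroup ℤ.*-commutativeSemigroup using () renaming (x∙yz≈y∙xz to *-left-comm)
open import Defs

DownClosedAt : ∀ {n} → BoolFun n → Bool → Set
DownClosedAt f c = ∀ x y → x ⊆ y → f y ≡ c → f x ≡ c

monotone⇒downClosed : ∀ {n} {f : BoolFun n} → Monotone f → ∃ (DownClosedAt f)
monotone⇒downClosed (nonIncreasing m) = true , λ x y x⊆y → m y x x⊆y
monotone⇒downClosed (nonDecreasing m) = false , λ x y x⊆y → m y x x⊆y

agree : ∀ {a b c : Bool} → (a ≡ c → b ≡ c) → (b ≡ c → a ≡ c) → a ≡ b
agree {false} {false} _ _ = refl
agree {true} {true} _ _ = refl
agree {false} {true} {false} a⇒b _ = sym (a⇒b refl)
agree {false} {true} {true} _ b⇒a = b⇒a refl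
agree {true} {false} {false} _ b⇒a = b⇒a refl
agree {true} {false} {true} a⇒b _ = sym (a⇒b refl)

_≗ᵢ_ : ∀ {n} → Input n → Input n → Set
x ≗ᵢ y = ∀ j → x j ≡ y j

≗⇒⊆ : ∀ {n} {x y : Input n} → x ≗ᵢ y → x ⊆ y
≗⇒⊆ x≗y j xj = trans (sym (x≗y j)) xj

-- Inputs are functions, so without extensionality a boolean function need not
-- respect pointwise equality; a monotone one does.
monotone-respects-≗ : ∀ {n} {f : BoolFun n} → Monotone f → ∀ x y → x ≗ᵢ y → f x ≡ f y
monotone-respects-≗ mo x y x≗y with monotone⇒downClosed mo
... | c , down = agree (down y x (≗⇒⊆ (λ j → sym (x≗y j)))) (down x y (≗⇒⊆ x≗y))

sandwich : ∀ {n} {f : BoolFun n} → Monotone f → ∀ {x y z} → x ⊆ y → y ⊆ z → f x ≡ f z → f y ≡ f x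
sandwich mo {x} {y} {z} x⊆y y⊆z fx≡fz with monotone⇒downClosed mo
... | c , down = agree (down x y x⊆y) (λ fx≡c → down y z y⊆z (trans (sym fx≡fz) fx≡c))

𝟘 𝟙 : ∀ {n} → Input n
𝟘 _ = false
𝟙 _ = true

monotone-ends : ∀ {n} {f : BoolFun n} → Monotone f → NonTrivial f → f 𝟘 ≢ f 𝟙
monotone-ends mo (x , y , fx≢fy) f𝟘≡f𝟙 =
  fx≢fy (trans (sandwich mo 𝟘⊆ ⊆𝟙 f𝟘≡f𝟙) (sym (sandwich mo 𝟘⊆ ⊆𝟙 f𝟘≡f𝟙)))
  where
  𝟘⊆ : ∀ {x} → 𝟘 ⊆ x
  𝟘⊆ i ()
  ⊆𝟙 : ∀ {x} → x ⊆ 𝟙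
  ⊆𝟙 i _ = refl

branch : ∀ {n} → Bool → DTree n → DTree n → DTree n
branch false l r = l
branch true  l r = r

eval-query : ∀ {n} j (l r : DTree n) x → eval (query j l r) x ≡ eval (branch (x j) l r) x
eval-query j l r x with x j
... | false = refl
... | true = refl

depth-branch : ∀ {n} b (l r : DTree n) → depth (branch b l r) ≤ depth l ⊔ depth r
depth-branch false l r = ℕ.m≤m⊔n (depth l) (depth r)
depth-branch true l r = ℕ.m≤n⊔m (depth l) (depth r)

rename : ∀ {n} → (Fin n → Fin n) → DTree n → DTree n
rename ρ (leaf b) = leaf b
rename ρ (query i l r) = query (ρ i) (rename ρ l) (rename ρ r)

eval-rename : ∀ {n} ρ (t : DTree n) x → eval (rename ρ t) x ≡ eval t (λ k → x (ρ k))
eval-rename ρ (leaf b) x = refl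
eval-rename ρ (query i l r) x with x (ρ i)
... | false = eval-rename ρ l x
... | true = eval-rename ρ r x

depth-rename : ∀ {n} ρ (t : DTree n) → depth (rename ρ t) ≡ depth t
depth-rename ρ (leaf b) = refl
depth-rename ρ (query i l r) = cong₂ (λ a b → suc (a ⊔ b)) (depth-rename ρ l) (depth-rename ρ r)

rename-computes : ∀ {n} {G : Permutation′ n → Set} {f : BoolFun n} → Invariant G f →
                  ∀ {σ} → G σ → ∀ t → Computes t f → Computes (rename (σ ⟨$⟩ˡ_) t) f
rename-computes inv {σ} σ∈G t t⊢f x =
  trans (eval-rename (σ ⟨$⟩ˡ_) t x) (trans (t⊢f (act σ x)) (inv σ σ∈G x))

queryAll : ∀ {n k} → Vec (Fin n) k → (Vec Bool k → Bool) → DTree n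
queryAll [] h = leaf (h [])
queryAll (i ∷ is) h = query i (queryAll is (λ v → h (false ∷ v))) (queryAll is (λ v → h (true ∷ v)))

eval-queryAll : ∀ {n k} (is : Vec (Fin n) k) h x → eval (queryAll is h) x ≡ h (map x is)
eval-queryAll [] h x = refl
eval-queryAll (i ∷ is) h x with x i
... | false = eval-queryAll is (λ v → h (false ∷ v)) x
... | true = eval-queryAll is (λ v → h (true ∷ v)) x

depth-queryAll : ∀ {n k} (is : Vec (Fin n) k) h → depth (queryAll is h) ≡ k
depth-queryAll [] h = refl
depth-queryAll {k = suc k} (i ∷ is) h =
  cong suc (trans (cong₂ _⊔_ (depth-queryAll is _) (depth-queryAll is _)) (ℕ.⊔-idem k))

complete-tree : ∀ {n} (f : BoolFun n) → (∀ x y → x ≗ᵢ y → f x ≡ f y) →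
                Σ (DTree n) λ t → Computes t f × depth t ≡ n
complete-tree {n} f f-ext = queryAll (allFin n) (λ v → f (lookup v)) , computes , depth-queryAll (allFin n) _
  where
  lookup-map-allFin : ∀ x j → lookup (map x (allFin n)) j ≡ x j
  lookup-map-allFin x j = trans (Vecₚ.lookup-map j x (allFin n)) (cong x (Vecₚ.lookup-allFin j))
  computes : Computes (queryAll (allFin n) (λ v → f (lookup v))) f
  computes x = trans (eval-queryAll (allFin n) _ x) (f-ext _ x (lookup-map-allFin x))

-- A pattern describes a subcube of {0,1}ⁿ: `just b` fixes a coordinate to b,
-- `nothing` leaves it free.
Pattern : ℕ → Set
Pattern n = Vec (Maybe Bool) n

free : ∀ {n} → Pattern n → ℕ
free [] = 0
free (nothing ∷ p) = suc (free p)
free (just _ ∷ p) = free p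

_∈ᶜ_ : ∀ {n} → Vec Bool n → Pattern n → Set
[] ∈ᶜ [] = ⊤
(a ∷ v) ∈ᶜ (nothing ∷ p) = v ∈ᶜ p
(a ∷ v) ∈ᶜ (just b ∷ p) = a ≡ b × v ∈ᶜ p

fixAt : ∀ {n} → Pattern n → Fin n → Bool → Pattern n
fixAt p j b = p [ j ]≔ just b

∈ᶜ-lookup : ∀ {n} (p : Pattern n) v j {b} → v ∈ᶜ p → lookup p j ≡ just b → lookup v j ≡ b
∈ᶜ-lookup (nothing ∷ p) (a ∷ v) fz v∈p ()
∈ᶜ-lookup (just _ ∷ p) (a ∷ v) fz (a≡b , _) refl = a≡b
∈ᶜ-lookup (nothing ∷ p) (a ∷ v) (fs j) v∈p = ∈ᶜ-lookup p v j v∈p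
∈ᶜ-lookup (just _ ∷ p) (a ∷ v) (fs j) (_ , v∈p) = ∈ᶜ-lookup p v j v∈p

free-fixAt : ∀ {n} (p : Pattern n) j b → lookup p j ≡ nothing → free p ≡ suc (free (fixAt p j b))
free-fixAt (nothing ∷ p) fz b _ = refl
free-fixAt (nothing ∷ p) (fs j) b j-free = cong suc (free-fixAt p j b j-free)
free-fixAt (just _ ∷ p) (fs j) b j-free = free-fixAt p j b j-free

opaque
  subcubeSum : ∀ {n} → Pattern n → (Vec Bool n → ℤ) → ℤ
  subcubeSum [] g = g []
  subcubeSum (nothing ∷ p) g = subcubeSum p (λ v → g (false ∷ v)) + subcubeSum p (λ v → g (true ∷ v))
  subcubeSum (just b ∷ p) g = subcubeSum p (λ v → g (b ∷ v))

  subcubeSum-cong : ∀ {n} (p : Pattern n) {g h : Vec Bool n → ℤ} →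
                    (∀ v → v ∈ᶜ p → g v ≡ h v) → subcubeSum p g ≡ subcubeSum p h
  subcubeSum-cong [] g≡h = g≡h [] tt
  subcubeSum-cong (nothing ∷ p) g≡h =
    cong₂ _+_ (subcubeSum-cong p (λ v → g≡h (false ∷ v))) (subcubeSum-cong p (λ v → g≡h (true ∷ v)))
  subcubeSum-cong (just b ∷ p) g≡h = subcubeSum-cong p (λ v v∈p → g≡h (b ∷ v) (refl , v∈p))

  subcubeSum-*ˡ : ∀ {n} (p : Pattern n) c g → subcubeSum p (λ v → c * g v) ≡ c * subcubeSum p g
  subcubeSum-*ˡ [] c g = refl
  subcubeSum-*ˡ (nothing ∷ p) c g =
    trans (cong₂ _+_ (subcubeSum-*ˡ p c _) (subcubeSum-*ˡ p c _)) (sym (ℤ.*-distribˡ-+ c _ _))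
  subcubeSum-*ˡ (just b ∷ p) c g = subcubeSum-*ˡ p c _

  subcubeSum-+ : ∀ {n} (p : Pattern n) g h → subcubeSum p (λ v → g v + h v) ≡ subcubeSum p g + subcubeSum p h
  subcubeSum-+ [] g h = refl
  subcubeSum-+ {suc n} (nothing ∷ p) g h =
    trans (cong₂ _+_ (subcubeSum-+ p g₀ h₀) (subcubeSum-+ p g₁ h₁))
          (+-interchange (subcubeSum p g₀) (subcubeSum p h₀) (subcubeSum p g₁) (subcubeSum p h₁))
    where
    g₀ g₁ h₀ h₁ : Vec Bool n → ℤ
    g₀ v = g (false ∷ v)
    g₁ v = g (true ∷ v)
    h₀ v = h (false ∷ v)
    h₁ v = h (true ∷ v)
  subcubeSum-+ (just b ∷ p) g h = subcubeSum-+ p _ _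

  subcubeSum-split : ∀ {n} (p : Pattern n) j g → lookup p j ≡ nothing →
                     subcubeSum p g ≡ subcubeSum (fixAt p j false) g + subcubeSum (fixAt p j true) g
  subcubeSum-split (nothing ∷ p) fz g _ = refl
  subcubeSum-split {suc n} (nothing ∷ p) (fs j) g j-free =
    trans (cong₂ _+_ (subcubeSum-split p j g₀ j-free) (subcubeSum-split p j g₁ j-free))
          (+-interchange (subcubeSum (fixAt p j false) g₀) (subcubeSum (fixAt p j true) g₀)
                         (subcubeSum (fixAt p j false) g₁) (subcubeSum (fixAt p j true) g₁))
    where
    g₀ g₁ : Vec Bool n → ℤ
    g₀ v = g (false ∷ v)
    g₁ v = g (true ∷ v)
  subcubeSum-split (just b ∷ p) (fs j) g j-free = subcubeSum-split p j _ j-free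

±1 : Bool → ℤ
±1 false = + 1
±1 true = -[1+ 0 ]

-- Kept opaque: unfolding a product of signs with an unknown entry duplicates it at
-- every factor (integer multiplication splits into sign and absolute value).
opaque
  sign : ∀ {n} → Vec Bool n → ℤ
  sign [] = + 1
  sign (a ∷ v) = ±1 a * sign v

⟦_⟧ : Bool → ℤ
⟦ false ⟧ = + 0
⟦ true ⟧ = + 1

opaque
  unfolding subcubeSum sign

  signed-volume : ∀ {n} (p : Pattern n) → 0 < free p → subcubeSum p sign ≡ + 0
  signed-volume (nothing ∷ p) _ =
    trans (cong₂ _+_ (trans (subcubeSum-*ˡ p (+ 1) sign) (ℤ.*-identityˡ _))
                     (trans (subcubeSum-*ˡ p -[1+ 0 ] sign) (ℤ.-1*i≡-i _)))
          (ℤ.+-inverseʳ (subcubeSum p sign))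
  signed-volume (just b ∷ p) 0<free =
    trans (subcubeSum-*ˡ p (±1 b) sign) (trans (cong (±1 b *_) (signed-volume p 0<free)) (ℤ.*-zeroʳ (±1 b)))

SignedSum : ∀ {n} → Pattern n → DTree n → ℤ
SignedSum p t = subcubeSum p (λ v → sign v * ⟦ eval t (lookup v) ⟧)

-- The Rivest–Vuillemin parity argument: a decision tree of depth smaller than the
-- dimension of a subcube has vanishing signed sum over it, since each leaf is
-- reached on a subcube of positive dimension.
shallow-tree-balanced : ∀ {n} (t : DTree n) (p : Pattern n) → depth t < free p → SignedSum p t ≡ + 0

-- Where the queried variable x_j is fixed to b, only the b-branch matters.
query-on-fixed : ∀ {n} j (l r : DTree n) b p → lookup p j ≡ just b →
                 depth l ⊔ depth r < free p → SignedSum p (query j l r) ≡ + 0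
query-on-fixed j l r b p j≡b d<free = trans (subcubeSum-cong p follows-branch) (branch-balanced b)
  where
  follows-branch : ∀ v → v ∈ᶜ p → sign v * ⟦ eval (query j l r) (lookup v) ⟧ ≡ sign v * ⟦ eval (branch b l r) (lookup v) ⟧
  follows-branch v v∈p = cong (λ z → sign v * ⟦ z ⟧)
    (trans (eval-query j l r (lookup v)) (cong (λ c → eval (branch c l r) (lookup v)) (∈ᶜ-lookup p v j v∈p j≡b)))
  branch-balanced : ∀ b → SignedSum p (branch b l r) ≡ + 0
  branch-balanced false = shallow-tree-balanced l p (ℕ.≤-<-trans (depth-branch false l r) d<free)
  branch-balanced true = shallow-tree-balanced r p (ℕ.≤-<-trans (depth-branch true l r) d<free)

shallow-tree-balanced (leaf c) p 0<free =
  trans (subcubeSum-cong p (λ v _ → ℤ.*-comm (sign v) ⟦ c ⟧))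
        (trans (subcubeSum-*ˡ p ⟦ c ⟧ sign) (trans (cong (⟦ c ⟧ *_) (signed-volume p 0<free)) (ℤ.*-zeroʳ ⟦ c ⟧)))
shallow-tree-balanced (query j l r) p d<free with lookup p j in j-status
... | just b = query-on-fixed j l r b p j-status (ℕ.<-trans (ℕ.n<1+n _) d<free)
... | nothing =
  trans (subcubeSum-split p j _ j-status)
        (cong₂ _+_ (query-on-fixed j l r false (fixAt p j false) (Vecₚ.lookup∘update j p _) (shrink false))
                   (query-on-fixed j l r true (fixAt p j true) (Vecₚ.lookup∘update j p _) (shrink true)))
  where
  shrink : ∀ b → depth l ⊔ depth r < free (fixAt p j b)
  shrink b = ℕ.≤-pred (subst (suc (depth (query j l r)) ≤_) (free-fixAt p j b j-status) d<free)

cube : ∀ n → Pattern n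
cube n = replicate n nothing

cubeSum : ∀ n → (Vec Bool n → ℤ) → ℤ
cubeSum n = subcubeSum (cube n)

∈-cube : ∀ {n} (v : Vec Bool n) → v ∈ᶜ cube n
∈-cube [] = tt
∈-cube (a ∷ v) = ∈-cube v

cubeSum-cong : ∀ n {g h : Vec Bool n → ℤ} → (∀ v → g v ≡ h v) → cubeSum n g ≡ cubeSum n h
cubeSum-cong n g≡h = subcubeSum-cong (cube n) (λ v _ → g≡h v)

rotate : ∀ {A : Set} {n} → Vec A (suc n) → Vec A (suc n)
rotate (a ∷ v) = v ∷ʳ a

bit : Bool → ℕ
bit false = 0
bit true = 1

ones : ∀ {n} → Vec Bool n → ℕ
ones [] = 0
ones (a ∷ v) = bit a ℕ.+ ones v

ones≤length : ∀ {n} (v : Vec Bool n) → ones v ≤ n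
ones≤length [] = ℕ.z≤n
ones≤length (false ∷ v) = ℕ.m≤n⇒m≤1+n (ones≤length v)
ones≤length (true ∷ v) = s≤s (ones≤length v)

ones-∷ʳ : ∀ {n} (v : Vec Bool n) a → ones (v ∷ʳ a) ≡ ones (a ∷ v)
ones-∷ʳ [] a = refl
ones-∷ʳ (b ∷ v) a = trans (cong (bit b ℕ.+_) (ones-∷ʳ v a)) (ℕ-+-left-comm (bit b) (bit a) (ones v))

ones-rotate : ∀ {n} (u : Vec Bool (suc n)) → ones (rotate u) ≡ ones u
ones-rotate (a ∷ v) = ones-∷ʳ v a

≤⇒≢ᵇsuc : ∀ {m n} → m ≤ n → (m ≡ᵇ suc n) ≡ false
≤⇒≢ᵇsuc ℕ.z≤n = refl
≤⇒≢ᵇsuc (s≤s m≤n) = ≤⇒≢ᵇsuc m≤n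

opaque
  unfolding sign

  sign-∷ʳ : ∀ {n} (v : Vec Bool n) a → sign (v ∷ʳ a) ≡ sign (a ∷ v)
  sign-∷ʳ [] a = refl
  sign-∷ʳ (c ∷ v) a = trans (cong (±1 c *_) (sign-∷ʳ v a)) (*-left-comm (±1 c) (±1 a) (sign v))

  sign-rotate-∷ʳ : ∀ {n} (u : Vec Bool (suc n)) b → sign (rotate u ∷ʳ b) ≡ sign (u ∷ʳ b)
  sign-rotate-∷ʳ (a ∷ v) b = begin
    sign ((v ∷ʳ a) ∷ʳ b) ≡⟨ sign-∷ʳ (v ∷ʳ a) b ⟩
    ±1 b * sign (v ∷ʳ a) ≡⟨ cong (±1 b *_) (sign-∷ʳ v a) ⟩
    ±1 b * sign (a ∷ v) ≡⟨ sym (sign-∷ʳ (a ∷ v) b) ⟩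
    sign ((a ∷ v) ∷ʳ b) ∎
    where open ≡-Reasoning

opaque
  unfolding subcubeSum

  cubeSum-zero : ∀ n → cubeSum n (λ _ → + 0) ≡ + 0
  cubeSum-zero zero = refl
  cubeSum-zero (suc n) = cong₂ _+_ (cubeSum-zero n) (cubeSum-zero n)

  cubeSum-∷ʳ : ∀ n (g : Vec Bool (suc n) → ℤ) →
               cubeSum (suc n) g ≡ cubeSum n (λ v → g (v ∷ʳ false)) + cubeSum n (λ v → g (v ∷ʳ true))
  cubeSum-∷ʳ zero g = refl
  cubeSum-∷ʳ (suc n) g =
    trans (cong₂ _+_ (cubeSum-∷ʳ n g₀) (cubeSum-∷ʳ n g₁))
          (+-interchange (cubeSum n (λ v → g₀ (v ∷ʳ false))) (cubeSum n (λ v → g₀ (v ∷ʳ true)))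
                         (cubeSum n (λ v → g₁ (v ∷ʳ false))) (cubeSum n (λ v → g₁ (v ∷ʳ true))))
    where
    g₀ g₁ : Vec Bool (suc n) → ℤ
    g₀ v = g (false ∷ v)
    g₁ v = g (true ∷ v)

  cubeSum-rotate : ∀ n (g : Vec Bool (suc n) → ℤ) → cubeSum (suc n) (λ u → g (rotate u)) ≡ cubeSum (suc n) g
  cubeSum-rotate n g = sym (cubeSum-∷ʳ n g)

  subcubeSum-last : ∀ n b (g : Vec Bool (suc n) → ℤ) → subcubeSum (cube n ∷ʳ just b) g ≡ cubeSum n (λ u → g (u ∷ʳ b))
  subcubeSum-last zero b g = refl
  subcubeSum-last (suc n) b g = cong₂ _+_ (subcubeSum-last n b _) (subcubeSum-last n b _)

  cubeSum-∣ : ∀ n {k} (g : Vec Bool n → ℤ) → (∀ v → k ∣ g v) → k ∣ cubeSum n g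
  cubeSum-∣ zero g k∣g = k∣g []
  cubeSum-∣ (suc n) g k∣g = ∣m∣n⇒∣m+n (cubeSum-∣ n _ (λ v → k∣g (false ∷ v))) (cubeSum-∣ n _ (λ v → k∣g (true ∷ v)))

  cubeSum-at-𝟘 : ∀ n (H : Vec Bool n → ℤ) → cubeSum n (λ u → H u * ⟦ ones u ≡ᵇ 0 ⟧) ≡ H (replicate n false)
  cubeSum-at-𝟘 zero H = ℤ.*-identityʳ (H [])
  cubeSum-at-𝟘 (suc n) H =
    trans (cong₂ _+_ (cubeSum-at-𝟘 n (λ v → H (false ∷ v)))
                     (trans (cubeSum-cong n (λ v → ℤ.*-zeroʳ (H (true ∷ v)))) (cubeSum-zero n)))
          (ℤ.+-identityʳ _)

  cubeSum-at-𝟙 : ∀ n (H : Vec Bool n → ℤ) → cubeSum n (λ u → H u * ⟦ ones u ≡ᵇ n ⟧) ≡ H (replicate n true)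
  cubeSum-at-𝟙 zero H = ℤ.*-identityʳ (H [])
  cubeSum-at-𝟙 (suc n) H =
    trans (cong₂ _+_ (trans (cubeSum-cong n (λ v → trans (cong (λ b → H (false ∷ v) * ⟦ b ⟧) (≤⇒≢ᵇsuc (ones≤length v)))
                                                         (ℤ.*-zeroʳ (H (false ∷ v)))))
                            (cubeSum-zero n))
                     (cubeSum-at-𝟙 n (λ v → H (true ∷ v))))
          (ℤ.+-identityˡ _)

  cubeSum-sum : ∀ n {k} (c : Fin k → Vec Bool n → ℤ) → cubeSum n (λ u → sum (λ j → c j u)) ≡ sum (λ j → cubeSum n (c j))
  cubeSum-sum n {zero} c = cubeSum-zero n
  cubeSum-sum n {suc k} c = trans (subcubeSum-+ (cube n) _ _) (cong (λ s → cubeSum n (c fz) + s) (cubeSum-sum n (λ j → c (fs j))))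

lookup-∷ʳ-inject₁ : ∀ {A : Set} {n} (v : Vec A n) a j → lookup (v ∷ʳ a) (inject₁ j) ≡ lookup v j
lookup-∷ʳ-inject₁ (b ∷ v) a fz = refl
lookup-∷ʳ-inject₁ (b ∷ v) a (fs j) = lookup-∷ʳ-inject₁ v a j

lookup-rotate : ∀ {A : Set} {n} (u : Vec A (suc n)) j → lookup (rotate u) (inject₁ j) ≡ lookup u (fs j)
lookup-rotate (a ∷ v) j = lookup-∷ʳ-inject₁ v a j

RotationInvariant : ∀ {n} → (Vec Bool (suc n) → ℤ) → Set
RotationInvariant X = ∀ u → X (rotate u) ≡ X u

column : ∀ {n} → (Vec Bool (suc n) → ℤ) → Fin (suc n) → ℤ
column {n} X j = cubeSum (suc n) (λ u → ⟦ lookup u j ⟧ * X u)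

-- For rotation-invariant X all column sums agree: rotating moves column j+1 to column j.
column-independent : ∀ {n} (X : Vec Bool (suc n) → ℤ) → RotationInvariant X → ∀ j → column X j ≡ column X fz
column-independent {n} X X-inv = <-weakInduction (λ j → column X j ≡ column X fz) refl
  (λ j col≡ → trans (sym (shift j)) col≡)
  where
  shift : ∀ j → column X (inject₁ j) ≡ column X (fs j)
  shift j = trans (sym (cubeSum-rotate n (λ u → ⟦ lookup u (inject₁ j) ⟧ * X u)))
                  (cubeSum-cong (suc n) (λ u → cong₂ (λ b x → ⟦ b ⟧ * x) (lookup-rotate u j) (X-inv u)))

ones-sum : ∀ {n} (u : Vec Bool n) → + ones u ≡ sum (λ j → ⟦ lookup u j ⟧)
ones-sum [] = refl
ones-sum (a ∷ v) = trans (ℤ.pos-+ (bit a) (ones v)) (cong₂ _+_ (bit-⟦⟧ a) (ones-sum v))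
  where
  bit-⟦⟧ : ∀ a → + bit a ≡ ⟦ a ⟧
  bit-⟦⟧ false = refl
  bit-⟦⟧ true = refl

sum-constant : ∀ k x → sum {k} (λ _ → x) ≡ + k * x
sum-constant zero x = sym (ℤ.*-zeroˡ x)
sum-constant (suc k) x = trans (cong (λ s → x + s) (sum-constant k x)) (sym (ℤ.suc-* (+ k) x))

weighted-count : ∀ {n} (X : Vec Bool (suc n) → ℤ) → RotationInvariant X →
                 cubeSum (suc n) (λ u → + ones u * X u) ≡ + suc n * column X fz
weighted-count {n} X X-inv = begin
  cubeSum (suc n) (λ u → + ones u * X u)
    ≡⟨ cubeSum-cong (suc n) (λ u → trans (cong (_* X u) (ones-sum u)) (*-distribʳ-sum (X u) (λ j → ⟦ lookup u j ⟧))) ⟩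
  cubeSum (suc n) (λ u → sum (λ j → ⟦ lookup u j ⟧ * X u))
    ≡⟨ cubeSum-sum (suc n) (λ j u → ⟦ lookup u j ⟧ * X u) ⟩
  sum (column X)
    ≡⟨ sum-cong-≗ (column-independent X X-inv) ⟩
  sum {suc n} (λ _ → column X fz)
    ≡⟨ sum-constant (suc n) (column X fz) ⟩
  + suc n * column X fz ∎
  where open ≡-Reasoning

-- Fermat's little theorem for 13, adjusted at the two ends:
-- d¹² + [d = 0] + [d = 13] ≡ 1 (mod 13) for every 0 ≤ d ≤ 13 (a finite check).
weight13 : ℕ → ℤ
weight13 d = (+ d) ^ 12 + ⟦ d ≡ᵇ 0 ⟧ + ⟦ d ≡ᵇ 13 ⟧

weight13≡1 : ∀ d → d ≤ 13 → + 13 ∣ weight13 d - + 1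
weight13≡1 d d≤13 = subst (λ m → + 13 ∣ weight13 m - + 1) (toℕ-fromℕ< (s≤s d≤13)) (checked (fromℕ< (s≤s d≤13)))
  where
  checked : ∀ (i : Fin 14) → + 13 ∣ weight13 (toℕ i) - + 1
  checked = toWitness {a? = all? (λ i → + 13 ∣? (weight13 (toℕ i) - + 1))} _

weighted13 : (Vec Bool 13 → ℤ) → Vec Bool 13 → ℤ
weighted13 H u = H u * weight13 (ones u)

weighted13-congruence : (H : Vec Bool 13 → ℤ) → + 13 ∣ cubeSum 13 (weighted13 H) - cubeSum 13 H
weighted13-congruence H = subst (+ 13 ∣_) (sym difference)
  (cubeSum-∣ 13 excess (λ u → ∣n⇒∣m*n (H u) (weight13≡1 (ones u) (ones≤length u))))
  where
  open ≡-Reasoning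
  excess : Vec Bool 13 → ℤ
  excess u = H u * (weight13 (ones u) - + 1)
  peel : ∀ (h w : ℤ) → h * w ≡ h * (w - + 1) + h
  peel = solve-∀
  cancel : ∀ (a c : ℤ) → a + c - c ≡ a
  cancel = solve-∀
  difference : cubeSum 13 (weighted13 H) - cubeSum 13 H ≡ cubeSum 13 excess
  difference = begin
    cubeSum 13 (weighted13 H) - cubeSum 13 H
      ≡⟨ cong (_- cubeSum 13 H) (trans (cubeSum-cong 13 (λ u → peel (H u) (weight13 (ones u))))
                                       (subcubeSum-+ (cube 13) excess H)) ⟩
    cubeSum 13 excess + cubeSum 13 H - cubeSum 13 H
      ≡⟨ cancel (cubeSum 13 excess) (cubeSum 13 H) ⟩
    cubeSum 13 excess ∎

-- For rotation-invariant H the weighted sum is H(𝟘) + H(𝟙) plus a multiple of 13: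
-- on 0 < |u| < 13 the weight is |u|·|u|¹¹, and the weighted count applies.
weighted13-ends : (H : Vec Bool 13 → ℤ) → RotationInvariant H →
                  cubeSum 13 (weighted13 H) ≡ + 13 * column (λ u → H u * (+ ones u) ^ 11) fz
                                              + (H (replicate 13 false) + H (replicate 13 true))
weighted13-ends H H-inv = begin
  cubeSum 13 (weighted13 H)
    ≡⟨ cubeSum-cong 13 (λ u → split-weight (H u) (+ ones u) ((+ ones u) ^ 11) ⟦ ones u ≡ᵇ 0 ⟧ ⟦ ones u ≡ᵇ 13 ⟧) ⟩
  cubeSum 13 (λ u → + ones u * X u + H u * ⟦ ones u ≡ᵇ 0 ⟧ + H u * ⟦ ones u ≡ᵇ 13 ⟧)
    ≡⟨ subcubeSum-+ (cube 13) (λ u → + ones u * X u + H u * ⟦ ones u ≡ᵇ 0 ⟧) (λ u → H u * ⟦ ones u ≡ᵇ 13 ⟧) ⟩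
  cubeSum 13 (λ u → + ones u * X u + H u * ⟦ ones u ≡ᵇ 0 ⟧) + Σ𝟙
    ≡⟨ cong (_+ Σ𝟙) (subcubeSum-+ (cube 13) (λ u → + ones u * X u) (λ u → H u * ⟦ ones u ≡ᵇ 0 ⟧)) ⟩
  cubeSum 13 (λ u → + ones u * X u) + cubeSum 13 (λ u → H u * ⟦ ones u ≡ᵇ 0 ⟧) + Σ𝟙
    ≡⟨ cong₂ (λ a b → a + b + Σ𝟙) (weighted-count X X-inv) (cubeSum-at-𝟘 13 H) ⟩
  + 13 * column X fz + H (replicate 13 false) + Σ𝟙
    ≡⟨ cong (λ s → + 13 * column X fz + H (replicate 13 false) + s) (cubeSum-at-𝟙 13 H) ⟩
  + 13 * column X fz + H (replicate 13 false) + H (replicate 13 true)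
    ≡⟨ ℤ.+-assoc (+ 13 * column X fz) (H (replicate 13 false)) (H (replicate 13 true)) ⟩
  + 13 * column X fz + (H (replicate 13 false) + H (replicate 13 true)) ∎
  where
  open ≡-Reasoning
  X : Vec Bool 13 → ℤ
  X u = H u * (+ ones u) ^ 11
  X-inv : RotationInvariant X
  X-inv u = cong₂ (λ h d → h * (+ d) ^ 11) (H-inv u) (ones-rotate u)
  Σ𝟙 : ℤ
  Σ𝟙 = cubeSum 13 (λ u → H u * ⟦ ones u ≡ᵇ 13 ⟧)
  split-weight : ∀ (h d e z o : ℤ) → h * (d * e + z + o) ≡ d * (h * e) + h * z + h * o
  split-weight = solve-∀

-- For rotation-invariant H on {0,1}¹³, Σ_u H(u) ≡ H(𝟘) + H(𝟙) (mod 13): the other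
-- points fall into rotation orbits of size 13.
cyclic-congruence : (H : Vec Bool 13 → ℤ) → RotationInvariant H →
                    + 13 ∣ cubeSum 13 H - (H (replicate 13 false) + H (replicate 13 true))
cyclic-congruence H H-inv =
  subst (+ 13 ∣_) (rearrange (cubeSum 13 (weighted13 H)) ends (cubeSum 13 H))
        (∣m∣n⇒∣m-n weighted≡ends (weighted13-congruence H))
  where
  ends : ℤ
  ends = H (replicate 13 false) + H (replicate 13 true)
  cancel : ∀ (a e : ℤ) → + 13 * a + e - e ≡ a * + 13
  cancel = solve-∀
  weighted≡ends : + 13 ∣ cubeSum 13 (weighted13 H) - ends
  weighted≡ends = divides Y (trans (cong (_- ends) (weighted13-ends H H-inv)) (cancel Y ends))
    where
    Y : ℤ
    Y = column (λ u → H u * (+ ones u) ^ 11) fz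
  rearrange : ∀ (a b c : ℤ) → (a - b) - (a - c) ≡ c - b
  rearrange = solve-∀

_≗?_ : ∀ {n} (x y : Input n) → Dec (x ≗ᵢ y)
x ≗? y = all? (λ j → x j Bool.≟ y j)

_⊆?_ : ∀ {n} (x y : Input n) → Dec (x ⊆ y)
x ⊆? y = all? (λ j → (x j Bool.≟ true) →-dec (y j Bool.≟ true))

tabulate-≗ : ∀ {n} {x : Input n} (v : Vec Bool n) → tabulate x ≡ v → ∀ j → x j ≡ lookup v j
tabulate-≗ {x = x} v x≡v j = trans (sym (Vecₚ.lookup∘tabulate x j)) (cong (λ w → lookup w j) x≡v)

tPow : ℕ → Permutation′ 14
tPow zero = id
tPow (suc k) = tPow k ∘ₚ genT

tPow∈G₅ : ∀ k → G₅ (tPow k)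
tPow∈G₅ zero = g-id
tPow∈G₅ (suc k) = g-∘ (tPow∈G₅ k) g-t

-- G₅ is transitive: toInfinity i relabels the point i as ∞ (via s ∘ tᵏ for a residue k).
toInfinity : Fin 14 → Permutation′ 14
toInfinity i = if toℕ i ≡ᵇ 13 then id else genS ∘ₚ tPow (toℕ i)

toInfinity∈G₅ : ∀ i → G₅ (toInfinity i)
toInfinity∈G₅ i with toℕ i ≡ᵇ 13
... | true = g-id
... | false = g-∘ g-s (tPow∈G₅ (toℕ i))

toInfinity-sends : ∀ i → toInfinity i ⟨$⟩ˡ i ≡ # 13
toInfinity-sends = toWitness {a? = all? (λ i → toInfinity i ⟨$⟩ˡ i ≟ᶠ # 13)} _

t-rotates : ∀ (u : Vec Bool 13) b → act genT (lookup (rotate u ∷ʳ b)) ≗ᵢ lookup (u ∷ʳ b)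
t-rotates (a₀ ∷ a₁ ∷ a₂ ∷ a₃ ∷ a₄ ∷ a₅ ∷ a₆ ∷ a₇ ∷ a₈ ∷ a₉ ∷ a₁₀ ∷ a₁₁ ∷ a₁₂ ∷ []) b =
  tabulate-≗ (a₀ ∷ a₁ ∷ a₂ ∷ a₃ ∷ a₄ ∷ a₅ ∷ a₆ ∷ a₇ ∷ a₈ ∷ a₉ ∷ a₁₀ ∷ a₁₁ ∷ a₁₂ ∷ b ∷ []) refl

bottom top : Bool → Input 14
bottom b = lookup (replicate 13 false ∷ʳ b)
top b = lookup (replicate 13 true ∷ʳ b)

opaque
  unfolding sign

  sign-bottom : ∀ b → sign (replicate 13 false ∷ʳ b) ≡ ±1 b
  sign-bottom false = refl
  sign-bottom true = refl

  sign-top : ∀ b → sign (replicate 13 true ∷ʳ b) ≡ - ±1 b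
  sign-top false = refl
  sign-top true = refl

13∤ : ∀ {z} → False (+ 13 ∣? z) → ¬ (+ 13 ∣ z)
13∤ = toWitnessFalse

ends-congruence : ∀ b x y → + 13 ∣ + 0 - (±1 b * ⟦ x ⟧ + - ±1 b * ⟦ y ⟧) → x ≡ y
ends-congruence b false false _ = refl
ends-congruence b true true _ = refl
ends-congruence false false true 13∣ = ⊥-elim (13∤ _ 13∣)
ends-congruence false true false 13∣ = ⊥-elim (13∤ _ 13∣)
ends-congruence true false true 13∣ = ⊥-elim (13∤ _ 13∣)
ends-congruence true true false 13∣ = ⊥-elim (13∤ _ 13∣)

module _ (f : BoolFun 14) (inv : Invariant G₅ f) (mo : Monotone f) where

  -- A tree of depth < 13 computing f on the hyperplane x_∞ = b forces f to agree at
  -- its bottom and top: the signed sum of f over the hyperplane vanishes by the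
  -- parity argument, and is ≡ ±(f(bottom) − f(top)) mod 13 since t rotates it.
  hyperplane-ends-agree : ∀ b (t : DTree 14) → (∀ v → lookup v (# 13) ≡ b → eval t (lookup v) ≡ f (lookup v)) →
                          depth t < 13 → f (bottom b) ≡ f (top b)
  hyperplane-ends-agree b t t⊢f shallow =
    ends-congruence b (f (bottom b)) (f (top b))
      (subst₂ (λ s e → + 13 ∣ s - e) signed-sum≡0 ends-signs (cyclic-congruence H H-inv))
    where
    H : Vec Bool 13 → ℤ
    H u = sign (u ∷ʳ b) * ⟦ f (lookup (u ∷ʳ b)) ⟧
    H-inv : RotationInvariant H
    H-inv u = cong₂ (λ s y → s * ⟦ y ⟧) (sign-rotate-∷ʳ u b)
      (trans (sym (inv genT g-t (lookup (rotate u ∷ʳ b)))) (monotone-respects-≗ mo _ _ (t-rotates u b)))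
    ends-signs : H (replicate 13 false) + H (replicate 13 true) ≡ ±1 b * ⟦ f (bottom b) ⟧ + - ±1 b * ⟦ f (top b) ⟧
    ends-signs = cong₂ (λ s s′ → s * ⟦ f (bottom b) ⟧ + s′ * ⟦ f (top b) ⟧) (sign-bottom b) (sign-top b)
    hyperplane : Pattern 14
    hyperplane = cube 13 ∷ʳ just b
    signed-sum≡0 : cubeSum 13 H ≡ + 0
    signed-sum≡0 = begin
      cubeSum 13 H
        ≡⟨ sym (subcubeSum-last 13 b (λ v → sign v * ⟦ f (lookup v) ⟧)) ⟩
      subcubeSum hyperplane (λ v → sign v * ⟦ f (lookup v) ⟧)
        ≡⟨ subcubeSum-cong hyperplane (λ v v∈ → cong (λ y → sign v * ⟦ y ⟧) (sym (t⊢f v (∈ᶜ-lookup hyperplane v (# 13) v∈ refl)))) ⟩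
      SignedSum hyperplane t
        ≡⟨ shallow-tree-balanced t hyperplane shallow ⟩
      + 0 ∎
      where open ≡-Reasoning

  -- Agreement on both hyperplanes contradicts non-triviality: e₀ = {0} lies between
  -- the bottom and top of x_∞ = 0, and s maps it to the bottom {∞} of x_∞ = 1.
  ends-agree : f (bottom false) ≡ f (top false) → f (bottom true) ≡ f (top true) → f 𝟘 ≡ f 𝟙
  ends-agree agree₀ agree₁ = begin
    f 𝟘                ≡⟨ monotone-respects-≗ mo _ _ (toWitness {a? = 𝟘 ≗? bottom false} _) ⟩
    f (bottom false)   ≡⟨ sym (sandwich mo (toWitness {a? = bottom false ⊆? e₀} _) (toWitness {a? = e₀ ⊆? top false} _) agree₀) ⟩
    f e₀               ≡⟨ sym (inv genS g-s e₀) ⟩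
    f (act genS e₀)    ≡⟨ monotone-respects-≗ mo _ _ (toWitness {a? = act genS e₀ ≗? bottom true} _) ⟩
    f (bottom true)    ≡⟨ agree₁ ⟩
    f (top true)       ≡⟨ monotone-respects-≗ mo _ _ (toWitness {a? = top true ≗? 𝟙} _) ⟩
    f 𝟙 ∎
    where
    open ≡-Reasoning
    e₀ : Input 14
    e₀ = lookup (true ∷ replicate 13 false)

  root-at-∞ : f 𝟘 ≢ f 𝟙 → ∀ l r → Computes (query (# 13) l r) f → 13 ≤ depth l ⊔ depth r
  root-at-∞ f𝟘≢f𝟙 l r t⊢f with 13 ℕ.≤? depth l ⊔ depth r
  ... | yes 13≤d = 13≤d
  ... | no 13≰d = ⊥-elim (f𝟘≢f𝟙 (ends-agree (branch-agrees false) (branch-agrees true)))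
    where
    branch-computes : ∀ b v → lookup v (# 13) ≡ b → eval (branch b l r) (lookup v) ≡ f (lookup v)
    branch-computes b v v∞≡b =
      trans (cong (λ c → eval (branch c l r) (lookup v)) (sym v∞≡b))
            (trans (sym (eval-query (# 13) l r (lookup v))) (t⊢f (lookup v)))
    branch-agrees : ∀ b → f (bottom b) ≡ f (top b)
    branch-agrees b = hyperplane-ends-agree b (branch b l r) (branch-computes b)
      (ℕ.≤-<-trans (depth-branch b l r) (ℕ.≰⇒> 13≰d))

  -- By transitivity the same holds whatever variable the root queries.
  root-anywhere : f 𝟘 ≢ f 𝟙 → ∀ i l r → Computes (query i l r) f → 13 ≤ depth l ⊔ depth r
  root-anywhere f𝟘≢f𝟙 i l r t⊢f =
    subst (13 ≤_) (cong₂ _⊔_ (depth-rename ρ l) (depth-rename ρ r))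
      (root-at-∞ f𝟘≢f𝟙 (rename ρ l) (rename ρ r)
        (subst (λ k → Computes (query k (rename ρ l) (rename ρ r)) f) (toInfinity-sends i)
          (rename-computes inv (toInfinity∈G₅ i) (query i l r) t⊢f)))
    where
    ρ : Fin 14 → Fin 14
    ρ = toInfinity i ⟨$⟩ˡ_

corollary1 : (f : BoolFun 14) → NonTrivial f → Invariant G₅ f → Monotone f → Elusive f
corollary1 f nt inv mo = complete-tree f (monotone-respects-≗ mo) , lower-bound
  where
  f𝟘≢f𝟙 : f 𝟘 ≢ f 𝟙
  f𝟘≢f𝟙 = monotone-ends mo nt
  lower-bound : ∀ t → Computes t f → 14 ≤ depth t
  lower-bound (leaf c) t⊢f = ⊥-elim (f𝟘≢f𝟙 (trans (sym (t⊢f 𝟘)) (t⊢f 𝟙)))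
  lower-bound (query i l r) t⊢f = s≤s (root-anywhere f inv mo f𝟘≢f𝟙 i l r t⊢f)
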